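{- Let $\ell\ge r\ge 3$ be integers and let $\mathcal{H}$ be an $r$-graph. Then $\mathcal{H}$ is $\mathcal{K}_{\ell+1}^r$-saturated if and only if (i) every $r$-set of vertices spanning a copy of $K_r$ in the graph $\partial_{r-2}\mathcal{H}$ is an edge of $\mathcal{H}$, and (ii) $\partial_{r-2}\mathcal{H}$ is $K_r$-maximal, $K_{\ell+1}$-free.
   Context: An $r$-graph is a set of vertices with a collection of $r$-element subsets (edges). For integers $\ell\ge r\ge 2$, $\mathcal{K}_{\ell+1}^r$ is the family of all $r$-graphs $F$ with at most $\binom{\ell+1}{2}$ edges such that for some $(\ell+1)$-set $S$ of vertices, every pair $\{u,v\}\subset S$ is contained in some edge of $F$. An $r$-graph $\mathcal{H}$ is $\mathcal{K}_{\ell+1}^r$-saturated if it contains no member of $\mathcal{K}_{\ell+1}^r$ as a subgraph, but adding any new $r$-set as an edge creates a subgraph isomorphic to a member of $\mathcal{K}_{\ell+1}^r$. The graph $\partial_{r-2}\mathcal{H}$ has vertex set $V(\mathcal{H})$ and edge set all pairs contained in some edge of $\mathcal{H}$. For a graph $G$, $N(K_r,G)$ denotes the number of copies of $K_r$ in $G$, and $\overline{G}$ is the complement of $G$. A graph $G$ is $K_r$-maximal, $K_{\ell+1}$-free if $G$ contains no $K_{\ell+1}$, and for every set $E'$ of non-edges of $G$ with $N(K_r,G+E')>N(K_r,G)$, the graph $G+E'$ contains a copy of $K_{\ell+1}$. -}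

module Defs where

open import Data.Nat using (ℕ; zero; suc; _+_; _≤_; _<_; _≡ᵇ_)
open import Data.Nat.Combinatorics using (_C_)
open import Data.Bool using (Bool; true; false; _∧_; _∨_; not; if_then_else_)
open import Data.Fin using (Fin)
open import Data.Fin.Properties using () renaming (_≟_ to _≟ᶠ_)
open import Data.Fin.Subset using (Subset; _∈_; ∣_∣)
open import Data.Vec using (Vec; []; _∷_; lookup)
open import Data.Vec.Properties using (≡-dec)
open import Data.List using (List; []; _∷_; _++_; map; filterᵇ; length; allFin)
open import Data.Bool.ListAction using (any; all)
open import Data.List.Relation.Unary.All using (All)
open import Data.List.Relation.Unary.Any using (Any)
open import Data.Product using (Σ; _×_)
open import Relation.Nullary using (¬_; does)
open import Relation.Binary.PropositionalEquality using (_≡_; _≢_)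
import Data.Bool.Properties as BP

allSubsets : (n : ℕ) → List (Subset n)
allSubsets zero = [] ∷ []
allSubsets (suc n) = map (true ∷_) (allSubsets n) ++ map (false ∷_) (allSubsets n)

EdgeSet : ℕ → Set
EdgeSet n = Subset n → Bool

record RGraph (n r : ℕ) : Set where
  field
    edge    : EdgeSet n
    uniform : ∀ e → edge e ≡ true → ∣ e ∣ ≡ r
open RGraph public

Graph : ℕ → Set
Graph n = Fin n → Fin n → Bool

addEdge : ∀ {n} → EdgeSet n → Subset n → EdgeSet n
addEdge E e f = E f ∨ does (≡-dec BP._≟_ f e)

-- H contains (as a subgraph) a member of K^r_{ℓ+1}: a family F of edges of H
-- with at most C(ℓ+1,2) edges and an (ℓ+1)-set S whose pairs are all covered by F.
ContainsKfam : ∀ {n} → (ℓ : ℕ) → EdgeSet n → Set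
ContainsKfam {n} ℓ E =
  Σ (List (Subset n)) λ F →
    All (λ e → E e ≡ true) F ×
    length F ≤ (suc ℓ) C 2 ×
    Σ (Subset n) λ S →
      ∣ S ∣ ≡ suc ℓ ×
      (∀ u v → u ∈ S → v ∈ S → u ≢ v → Any (λ e → u ∈ e × v ∈ e) F)

Saturated : ∀ {n} → (ℓ r : ℕ) → EdgeSet n → Set
Saturated {n} ℓ r E =
  ¬ ContainsKfam ℓ E ×
  (∀ (e : Subset n) → ∣ e ∣ ≡ r → E e ≡ false → ContainsKfam ℓ (addEdge E e))

shadow : ∀ {n} → EdgeSet n → Graph n
shadow {n} E u v =
  not (does (u ≟ᶠ v)) ∧ any (λ e → E e ∧ lookup e u ∧ lookup e v) (allSubsets n)

IsClique : ∀ {n} → Graph n → Subset n → Set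
IsClique G S = ∀ u v → u ∈ S → v ∈ S → u ≢ v → G u v ≡ true

isCliqueᵇ : ∀ {n} → Graph n → Subset n → Bool
isCliqueᵇ {n} G S =
  all (λ u → all (λ v → not (lookup S u ∧ lookup S v ∧ not (does (u ≟ᶠ v))) ∨ G u v)
                 (allFin n))
      (allFin n)

HasK : ∀ {n} → ℕ → Graph n → Set
HasK {n} k G = Σ (Subset n) λ S → ∣ S ∣ ≡ k × IsClique G S

NK : ∀ {n} → ℕ → Graph n → ℕ
NK {n} r G = length (filterᵇ (λ S → (∣ S ∣ ≡ᵇ r) ∧ isCliqueᵇ G S) (allSubsets n))

NonEdgeSet : ∀ {n} → Graph n → Graph n → Set
NonEdgeSet G E' =
  (∀ u v → E' u v ≡ E' v u) ×
  (∀ u → E' u u ≡ false) ×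
  (∀ u v → E' u v ≡ true → G u v ≡ false)

addEdges : ∀ {n} → Graph n → Graph n → Graph n
addEdges G E' u v = G u v ∨ E' u v

KrMaximalFree : ∀ {n} → (r ℓ : ℕ) → Graph n → Set
KrMaximalFree {n} r ℓ G =
  ¬ HasK (suc ℓ) G ×
  (∀ (E' : Graph n) → NonEdgeSet G E' →
     NK r G < NK r (addEdges G E') → HasK (suc ℓ) (addEdges G E'))

CondI : ∀ {n} → (r : ℕ) → EdgeSet n → Set
CondI {n} r E = ∀ (S : Subset n) → ∣ S ∣ ≡ r → IsClique (shadow E) S → E S ≡ true

{-# OPTIONS --safe #-}
module Submission where

-- A member of K^r_{ℓ+1} in H is the same thing as a K_{ℓ+1} in the shadow ∂H: pick one
-- edge of H through each pair of the clique.  Adding an r-set S to H adds to ∂H only pairs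
-- inside S, so a K_{ℓ+1} created by adding S lives in ∂H together with a clique on S.
-- Hence, if H is saturated, a non-edge S that is already a K_r in ∂H could be added
-- without creating a K_{ℓ+1}, which gives (i); and a set of new graph edges creating a
-- new K_r on some S (a non-edge of H, as edges are cliques of ∂H) contains all pairs of S,
-- so adding S to H yields a K_{ℓ+1} inside the enlarged graph, which gives (ii).
-- Conversely, for a non-edge e of size r, (i) says e is not a clique of ∂H, so completing
-- e to a clique raises N(K_r); by (ii) this creates a K_{ℓ+1}, which lies in ∂(H + e).

open import Defs
open import Data.Nat using (ℕ; suc; _+_; _≤_; _<_; _≡ᵇ_; z≤n; s≤s)
open import Data.Nat.Properties using (≤-trans; ≤-reflexive; n≤1+n; m≤n⇒m≤1+n; ≡ᵇ⇒≡; ≡⇒≡ᵇ)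
open import Data.Nat.Combinatorics using (_C_; nC1≡n; nCk+nC[k+1]≡[n+1]C[k+1])
open import Data.Bool using (Bool; true; false; _∧_; _∨_; not; T)
open import Data.Bool.Properties using (T-≡; ∧-conicalˡ; ∧-conicalʳ; ¬-not)
import Data.Bool.Properties as Bool
open import Data.Bool.ListAction using (any; all)
open import Data.Fin using (Fin)
import Data.Fin as Fin
open import Data.Fin.Properties using () renaming (_≟_ to _≟ᶠ_)
open import Data.Fin.Subset using (Subset; _∈_; ∣_∣)
open import Data.Fin.Subset.Properties using (_∈?_)
open import Data.Vec using ([]; _∷_; lookup)
open import Data.Vec.Properties using (≡-dec; []=⇒lookup; lookup⇒[]=)
open import Data.List using (List; []; _∷_; _++_; map; filterᵇ; length; allFin; find; mapMaybe)
open import Data.List.Properties using (length-++; length-map; length-mapMaybe)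
open import Data.List.Relation.Unary.All using (All)
import Data.List.Relation.Unary.All as All
import Data.List.Relation.Unary.All.Properties as All
open import Data.List.Relation.Unary.Any using (Any; here; there)
import Data.List.Relation.Unary.Any as Any
import Data.List.Relation.Unary.Any.Properties as Any
open import Data.List.Membership.Propositional using (lose) renaming (_∈_ to _∈ₗ_)
open import Data.List.Membership.Propositional.Properties using (∈-++⁺ˡ; ∈-++⁺ʳ; ∈-map⁺; ∈-allFin)
open import Data.Maybe using (Maybe)
import Data.Maybe.Relation.Unary.All as MaybeAll
import Data.Maybe.Relation.Unary.Any as MaybeAny
open import Data.Product using (_×_; _,_; ∃; proj₁; proj₂; swap)
open import Data.Sum using (_⊎_; inj₁; inj₂)
open import Function using (_∘_; id)
open import Function.Bundles using (_⇔_; mk⇔; Equivalence)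
open import Relation.Nullary using (¬_; does; yes; no; contradiction)
open import Relation.Nullary.Decidable using (dec-true; dec-false; _×-dec_)
open import Relation.Unary using (Decidable)
open import Relation.Binary.PropositionalEquality
  using (_≡_; _≢_; refl; sym; trans; cong; cong₂; module ≡-Reasoning)
open ≡-Reasoning

open Equivalence using (to; from)

private variable
  A : Set
  n k ℓ r : ℕ

pairs : List A → List (A × A)
pairs []       = []
pairs (x ∷ xs) = map (x ,_) xs ++ pairs xs

length-pairs : (xs : List A) → length (pairs xs) ≡ length xs C 2
length-pairs [] = refl
length-pairs (x ∷ xs) = begin
  length (map (x ,_) xs ++ pairs xs)           ≡⟨ length-++ (map (x ,_) xs) ⟩
  length (map (x ,_) xs) + length (pairs xs)   ≡⟨ cong₂ _+_ (length-map (x ,_) xs) (length-pairs xs) ⟩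
  length xs + length xs C 2                    ≡⟨ cong (_+ length xs C 2) (sym (nC1≡n (length xs))) ⟩
  length xs C 1 + length xs C 2                ≡⟨ nCk+nC[k+1]≡[n+1]C[k+1] (length xs) 1 ⟩
  suc (length xs) C 2                          ∎

∈-pairs : ∀ {u v} (xs : List A) → u ∈ₗ xs → v ∈ₗ xs → u ≢ v →
          (u , v) ∈ₗ pairs xs ⊎ (v , u) ∈ₗ pairs xs
∈-pairs (x ∷ xs) (here refl) (here refl) u≢v = contradiction refl u≢v
∈-pairs (x ∷ xs) (here refl) (there v∈)  _   = inj₁ (∈-++⁺ˡ (∈-map⁺ (x ,_) v∈))
∈-pairs (x ∷ xs) (there u∈)  (here refl) _   = inj₂ (∈-++⁺ˡ (∈-map⁺ (x ,_) u∈))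
∈-pairs (x ∷ xs) (there u∈)  (there v∈)  u≢v with ∈-pairs xs u∈ v∈ u≢v
... | inj₁ uv∈ = inj₁ (∈-++⁺ʳ (map (x ,_) xs) uv∈)
... | inj₂ vu∈ = inj₂ (∈-++⁺ʳ (map (x ,_) xs) vu∈)

find-sound : {P : A → Set} (P? : Decidable P) (xs : List A) → MaybeAll.All P (find P? xs)
find-sound P? []       = MaybeAll.nothing
find-sound P? (x ∷ xs) with P? x
... | yes px = MaybeAll.just px
... | no  _  = find-sound P? xs

find-complete : {P : A → Set} (P? : Decidable P) {xs : List A} → Any P xs →
                MaybeAny.Any P (find P? xs)
find-complete P? {x ∷ _} pxs with P? x
... | yes px = MaybeAny.just px
find-complete P? (here px)   | no ¬px = contradiction px ¬px
find-complete P? (there pxs) | no _   = find-complete P? pxs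

module _ (p q : A → Bool) where

  filterᵇ-<-witness : ∀ xs → length (filterᵇ p xs) < length (filterᵇ q xs) →
                      ∃ λ x → q x ≡ true × p x ≡ false
  filterᵇ-<-witness (x ∷ xs) lt with p x in px | q x in qx
  ... | false | true  = x , qx , px
  ... | true  | true  with s≤s lt′ ← lt = filterᵇ-<-witness xs lt′
  ... | false | false = filterᵇ-<-witness xs lt
  ... | true  | false = filterᵇ-<-witness xs (≤-trans (n≤1+n _) lt)

  module _ (p⇒q : ∀ x → p x ≡ true → q x ≡ true) where

    length-filterᵇ-mono : ∀ xs → length (filterᵇ p xs) ≤ length (filterᵇ q xs)
    length-filterᵇ-mono [] = z≤n
    length-filterᵇ-mono (x ∷ xs) with p x in px | q x in qx
    ... | true  | true  = s≤s (length-filterᵇ-mono xs)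
    ... | true  | false = contradiction (trans (sym (p⇒q x px)) qx) λ ()
    ... | false | true  = m≤n⇒m≤1+n (length-filterᵇ-mono xs)
    ... | false | false = length-filterᵇ-mono xs

    length-filterᵇ-< : ∀ {x} xs → x ∈ₗ xs → q x ≡ true → p x ≡ false →
                       length (filterᵇ p xs) < length (filterᵇ q xs)
    length-filterᵇ-< (x ∷ xs) (here refl) qx px rewrite qx | px = s≤s (length-filterᵇ-mono xs)
    length-filterᵇ-< (y ∷ xs) (there x∈) qx px with p y in py | q y in qy
    ... | true  | true  = s≤s (length-filterᵇ-< xs x∈ qx px)
    ... | true  | false = contradiction (trans (sym (p⇒q y py)) qy) λ ()
    ... | false | true  = m≤n⇒m≤1+n (length-filterᵇ-< xs x∈ qx px)
    ... | false | false = length-filterᵇ-< xs x∈ qx px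

elements : Subset n → List (Fin n)
elements []          = []
elements (true  ∷ s) = Fin.zero ∷ map Fin.suc (elements s)
elements (false ∷ s) = map Fin.suc (elements s)

length-elements : (S : Subset n) → length (elements S) ≡ ∣ S ∣
length-elements []          = refl
length-elements (true  ∷ s) = cong suc (trans (length-map Fin.suc (elements s)) (length-elements s))
length-elements (false ∷ s) = trans (length-map Fin.suc (elements s)) (length-elements s)

∈-elements : ∀ {u : Fin n} (S : Subset n) → u ∈ S → u ∈ₗ elements S
∈-elements (true  ∷ s) Data.Vec.here       = here refl
∈-elements (true  ∷ s) (Data.Vec.there u∈) = there (∈-map⁺ Fin.suc (∈-elements s u∈))
∈-elements (false ∷ s) (Data.Vec.there u∈) = ∈-map⁺ Fin.suc (∈-elements s u∈)

∈-allSubsets : (S : Subset n) → S ∈ₗ allSubsets n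
∈-allSubsets []          = here refl
∈-allSubsets {suc n} (true  ∷ S) = ∈-++⁺ˡ (∈-map⁺ (true ∷_) (∈-allSubsets S))
∈-allSubsets {suc n} (false ∷ S) =
  ∈-++⁺ʳ (map (true ∷_) (allSubsets n)) (∈-map⁺ (false ∷_) (∈-allSubsets S))

_⊆ᴳ_ : Graph n → Graph n → Set
G ⊆ᴳ G′ = ∀ u v → G u v ≡ true → G′ u v ≡ true

IsClique-mono : ∀ {G G′ : Graph n} {S} → G ⊆ᴳ G′ → IsClique G S → IsClique G′ S
IsClique-mono G⊆G′ cl u v u∈ v∈ u≢v = G⊆G′ u v (cl u v u∈ v∈ u≢v)

HasK-mono : ∀ {G G′ : Graph n} → G ⊆ᴳ G′ → HasK k G → HasK k G′
HasK-mono G⊆G′ (S , ∣S∣ , cl) = S , ∣S∣ , IsClique-mono G⊆G′ cl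

addEdges-⊇ : (G E′ : Graph n) → G ⊆ᴳ addEdges G E′
addEdges-⊇ G E′ u v Guv = cong (_∨ E′ u v) Guv

addEdges-⊆ : ∀ {G E′ G″ : Graph n} → G ⊆ᴳ G″ → E′ ⊆ᴳ G″ → addEdges G E′ ⊆ᴳ G″
addEdges-⊆ {G = G} G⊆ E′⊆ u v h with G u v in Guv
... | true  = G⊆ u v Guv
... | false = E′⊆ u v h

isCliquePairᵇ : Graph n → Subset n → Fin n → Fin n → Bool
isCliquePairᵇ G S u v = not (lookup S u ∧ lookup S v ∧ not (does (u ≟ᶠ v))) ∨ G u v

isCliquePairᵇ-intro : ∀ (G : Graph n) S u v → (u ∈ S → v ∈ S → u ≢ v → G u v ≡ true) →
                      isCliquePairᵇ G S u v ≡ true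
isCliquePairᵇ-intro G S u v h with lookup S u in Su | lookup S v in Sv | u ≟ᶠ v
... | false | _     | _       = refl
... | true  | false | _       = refl
... | true  | true  | yes _   = refl
... | true  | true  | no  u≢v = h (lookup⇒[]= u S Su) (lookup⇒[]= v S Sv) u≢v

isCliquePairᵇ-elim : ∀ (G : Graph n) S {u v} → isCliquePairᵇ G S u v ≡ true →
                     u ∈ S → v ∈ S → u ≢ v → G u v ≡ true
isCliquePairᵇ-elim G S {u} {v} ok u∈ v∈ u≢v
  rewrite []=⇒lookup u∈ | []=⇒lookup v∈ | dec-false (u ≟ᶠ v) u≢v = ok

isCliqueᵇ-intro : (G : Graph n) (S : Subset n) → IsClique G S → isCliqueᵇ G S ≡ true
isCliqueᵇ-intro {n} G S cl = to T-≡ (All.all⁻ (λ u → all (isCliquePairᵇ G S u) (allFin n)) {allFin n}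
  (All.tabulate λ {u} _ → All.all⁻ (isCliquePairᵇ G S u) {allFin n}
    (All.tabulate λ {v} _ → from T-≡ (isCliquePairᵇ-intro G S u v (cl u v)))))

isCliqueᵇ-elim : (G : Graph n) (S : Subset n) → isCliqueᵇ G S ≡ true → IsClique G S
isCliqueᵇ-elim {n} G S h u v = isCliquePairᵇ-elim G S (to T-≡ (All.lookup row (∈-allFin v)))
  where
  row : All (T ∘ isCliquePairᵇ G S u) (allFin n)
  row = All.all⁺ (isCliquePairᵇ G S u) (allFin n)
          (All.lookup (All.all⁺ (λ w → all (isCliquePairᵇ G S w) (allFin n)) (allFin n) (from T-≡ h))
                      (∈-allFin u))

isKrᵇ : ℕ → Graph n → Subset n → Bool
isKrᵇ r G S = (∣ S ∣ ≡ᵇ r) ∧ isCliqueᵇ G S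

isKrᵇ-intro : ∀ (G : Graph n) S → ∣ S ∣ ≡ r → IsClique G S → isKrᵇ r G S ≡ true
isKrᵇ-intro {r = r} G S ∣S∣ cl =
  cong₂ _∧_ (to T-≡ (≡⇒≡ᵇ ∣ S ∣ r ∣S∣)) (isCliqueᵇ-intro G S cl)

isKrᵇ-elim : ∀ (G : Graph n) S → isKrᵇ r G S ≡ true → ∣ S ∣ ≡ r × IsClique G S
isKrᵇ-elim {r = r} G S h =
  ≡ᵇ⇒≡ ∣ S ∣ r (from T-≡ (∧-conicalˡ _ _ h)) , isCliqueᵇ-elim G S (∧-conicalʳ _ _ h)

NK-<⇒newClique : ∀ {G G′ : Graph n} → NK r G < NK r G′ →
                 ∃ λ S → ∣ S ∣ ≡ r × IsClique G′ S × ¬ IsClique G S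
NK-<⇒newClique {n} {r} {G} {G′} lt
  with S , new , ¬old ← filterᵇ-<-witness (isKrᵇ r G) (isKrᵇ r G′) (allSubsets n) lt
  with ∣S∣ , cl ← isKrᵇ-elim G′ S new =
  S , ∣S∣ , cl , λ old → contradiction (trans (sym (isKrᵇ-intro G S ∣S∣ old)) ¬old) λ ()

newClique⇒NK-< : ∀ {G G′ : Graph n} {S} → G ⊆ᴳ G′ →
                 ∣ S ∣ ≡ r → IsClique G′ S → ¬ IsClique G S → NK r G < NK r G′
newClique⇒NK-< {n} {r} {G} {G′} {S} G⊆G′ ∣S∣ cl ¬old =
  length-filterᵇ-< (isKrᵇ r G) (isKrᵇ r G′) Kr⇒Kr′ (allSubsets n) (∈-allSubsets S)
    (isKrᵇ-intro G′ S ∣S∣ cl) (¬-not (¬old ∘ proj₂ ∘ isKrᵇ-elim G S))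
  where
  Kr⇒Kr′ : ∀ T → isKrᵇ r G T ≡ true → isKrᵇ r G′ T ≡ true
  Kr⇒Kr′ T h with ∣T∣ , clT ← isKrᵇ-elim G T h = isKrᵇ-intro G′ T ∣T∣ (IsClique-mono G⊆G′ clT)

Covers : EdgeSet n → Fin n → Fin n → Subset n → Set
Covers E u v e = E e ≡ true × u ∈ e × v ∈ e

covers? : (E : EdgeSet n) (u v : Fin n) → Decidable (Covers E u v)
covers? E u v e = (E e Bool.≟ true) ×-dec (u ∈? e) ×-dec (v ∈? e)

module _ (E : EdgeSet n) {u v : Fin n} where

  coversᵇ-intro : ∀ {e} → Covers E u v e → (E e ∧ lookup e u ∧ lookup e v) ≡ true
  coversᵇ-intro (Ee , u∈ , v∈) = cong₂ _∧_ Ee (cong₂ _∧_ ([]=⇒lookup u∈) ([]=⇒lookup v∈))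

  coversᵇ-elim : ∀ e → (E e ∧ lookup e u ∧ lookup e v) ≡ true → Covers E u v e
  coversᵇ-elim e h =
    ∧-conicalˡ (E e) _ h ,
    lookup⇒[]= u e (∧-conicalˡ _ (lookup e v) uv) ,
    lookup⇒[]= v e (∧-conicalʳ (lookup e u) _ uv)
    where
    uv : lookup e u ∧ lookup e v ≡ true
    uv = ∧-conicalʳ (E e) _ h

  shadow-intro : ∀ {e} → u ≢ v → Covers E u v e → shadow E u v ≡ true
  shadow-intro {e} u≢v c = cong₂ _∧_ (cong not (dec-false (u ≟ᶠ v) u≢v))
    (to T-≡ (Any.any⁺ _ (lose (∈-allSubsets e) (from T-≡ (coversᵇ-intro c)))))

  shadow-elim : shadow E u v ≡ true → u ≢ v × ∃ (Covers E u v)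
  shadow-elim h
    with e , covered ← Any.satisfied (Any.any⁻ _ (allSubsets n) (from T-≡ (∧-conicalʳ _ _ h))) =
    u≢v , e , coversᵇ-elim e (to T-≡ covered)
    where
    u≢v : u ≢ v
    u≢v u≡v = contradiction (trans (cong not (sym (dec-true (u ≟ᶠ v) u≡v))) (∧-conicalˡ _ _ h)) λ ()

shadow-sym : (E : EdgeSet n) → ∀ u v → shadow E u v ≡ true → shadow E v u ≡ true
shadow-sym E u v h with u≢v , e , Ee , u∈ , v∈ ← shadow-elim E h =
  shadow-intro E (u≢v ∘ sym) (Ee , v∈ , u∈)

shadow-mono : ∀ {E E′ : EdgeSet n} → (∀ e → E e ≡ true → E′ e ≡ true) → shadow E ⊆ᴳ shadow E′
shadow-mono {E′ = E′} E⊆E′ u v h with u≢v , e , Ee , u∈ , v∈ ← shadow-elim _ h =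
  shadow-intro E′ u≢v (E⊆E′ e Ee , u∈ , v∈)

edge-isClique : ∀ (E : EdgeSet n) {e} → E e ≡ true → IsClique (shadow E) e
edge-isClique E Ee u v u∈ v∈ u≢v = shadow-intro E u≢v (Ee , u∈ , v∈)

containsK⇒hasK : (E : EdgeSet n) → ContainsKfam ℓ E → HasK (suc ℓ) (shadow E)
containsK⇒hasK E (F , edges , _ , S , ∣S∣ , covered) = S , ∣S∣ , λ u v u∈ v∈ u≢v →
  let Ee , u∈e , v∈e = All.lookupAny edges (covered u v u∈ v∈ u≢v)
  in shadow-intro E u≢v (Ee , u∈e , v∈e)

hasK⇒containsK : (E : EdgeSet n) → HasK (suc ℓ) (shadow E) → ContainsKfam ℓ E
hasK⇒containsK {n} {ℓ} E (S , ∣S∣ , cl) = F , edges , size , S , ∣S∣ , covered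
  where
  coveringEdge : Fin n × Fin n → Maybe (Subset n)
  coveringEdge (u , v) = find (covers? E u v) (allSubsets n)

  F : List (Subset n)
  F = mapMaybe coveringEdge (pairs (elements S))

  edges : All (λ e → E e ≡ true) F
  edges = All.mapMaybe⁺ {f = coveringEdge} (All.map⁺ (All.universal
    (λ (u , v) → MaybeAll.map proj₁ (find-sound (covers? E u v) (allSubsets n)))
    (pairs (elements S))))

  size : length F ≤ suc ℓ C 2
  size = ≤-trans (length-mapMaybe coveringEdge (pairs (elements S))) (≤-reflexive (begin
    length (pairs (elements S))  ≡⟨ length-pairs (elements S) ⟩
    length (elements S) C 2      ≡⟨ cong (_C 2) (trans (length-elements S) ∣S∣) ⟩
    suc ℓ C 2                    ∎))

  coveredPair : ∀ u v → (u , v) ∈ₗ pairs (elements S) → shadow E u v ≡ true →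
                Any (λ e → u ∈ e × v ∈ e) F
  coveredPair u v uv∈ h with _ , e , c ← shadow-elim E h =
    Any.mapMaybe⁺ coveringEdge (pairs (elements S)) (Any.map⁺ (lose uv∈
      (MaybeAny.map proj₂ (find-complete (covers? E u v) (lose (∈-allSubsets e) c)))))

  covered : ∀ u v → u ∈ S → v ∈ S → u ≢ v → Any (λ e → u ∈ e × v ∈ e) F
  covered u v u∈ v∈ u≢v with ∈-pairs (elements S) (∈-elements S u∈) (∈-elements S v∈) u≢v
  ... | inj₁ uv∈ = coveredPair u v uv∈ (cl u v u∈ v∈ u≢v)
  ... | inj₂ vu∈ = Any.map swap (coveredPair v u vu∈ (cl v u v∈ u∈ (u≢v ∘ sym)))

addEdge-⊇ : (E : EdgeSet n) (S : Subset n) → ∀ e → E e ≡ true → addEdge E S e ≡ true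
addEdge-⊇ E S e Ee = cong (_∨ _) Ee

addEdge-new : (E : EdgeSet n) (S : Subset n) → addEdge E S S ≡ true
addEdge-new E S with E S
... | true  = refl
... | false = dec-true (≡-dec Bool._≟_ S S) refl

addEdge-elim : (E : EdgeSet n) (S : Subset n) → ∀ {e} → addEdge E S e ≡ true → E e ≡ true ⊎ e ≡ S
addEdge-elim E S {e} h with E e | ≡-dec Bool._≟_ e S
... | true  | _       = inj₁ refl
... | false | yes e≡S = inj₂ e≡S

shadow-addEdge-⊆ : ∀ (E : EdgeSet n) {S G} → shadow E ⊆ᴳ G → IsClique G S →
                   shadow (addEdge E S) ⊆ᴳ G
shadow-addEdge-⊆ E {S} ∂E⊆G cl u v h with u≢v , e , Ee , u∈ , v∈ ← shadow-elim (addEdge E S) h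
  with addEdge-elim E S Ee
... | inj₁ Ee′ = ∂E⊆G u v (shadow-intro E u≢v (Ee′ , u∈ , v∈))
... | inj₂ refl = cl u v u∈ v∈ u≢v

missingPairs : Graph n → Subset n → Graph n
missingPairs G e u v = not (G u v) ∧ lookup e u ∧ lookup e v ∧ not (does (u ≟ᶠ v))

module _ (G : Graph n) (e : Subset n) where

  missingPairs-intro : ∀ {u v} → G u v ≡ false → u ∈ e → v ∈ e → u ≢ v →
                       missingPairs G e u v ≡ true
  missingPairs-intro {u} {v} Guv u∈ v∈ u≢v =
    cong₂ _∧_ (cong not Guv)
      (cong₂ _∧_ ([]=⇒lookup u∈) (cong₂ _∧_ ([]=⇒lookup v∈) (cong not (dec-false (u ≟ᶠ v) u≢v))))

  missingPairs-elim : ∀ {u v} → missingPairs G e u v ≡ true →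
                      G u v ≡ false × u ∈ e × v ∈ e × u ≢ v
  missingPairs-elim {u} {v} h with G u v | lookup e u in eu | lookup e v in ev | u ≟ᶠ v
  ... | false | true | true | no u≢v = refl , lookup⇒[]= u e eu , lookup⇒[]= v e ev , u≢v

  missingPairs-nonEdgeSet : (∀ u v → G u v ≡ true → G v u ≡ true) → NonEdgeSet G (missingPairs G e)
  missingPairs-nonEdgeSet G-sym = symmetric , loopless , disjoint
    where
    flip : ∀ {u v} → missingPairs G e u v ≡ true → missingPairs G e v u ≡ true
    flip {u} {v} h with Guv , u∈ , v∈ , u≢v ← missingPairs-elim h =
      missingPairs-intro (¬-not λ Gvu → contradiction (trans (sym (G-sym v u Gvu)) Guv) λ ())
                         v∈ u∈ (u≢v ∘ sym)
    symmetric : ∀ u v → missingPairs G e u v ≡ missingPairs G e v u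
    symmetric u v with missingPairs G e u v in uv | missingPairs G e v u in vu
    ... | true  | true  = refl
    ... | false | false = refl
    ... | true  | false = trans (sym (flip uv)) vu
    ... | false | true  = trans (sym uv) (flip vu)
    loopless : ∀ u → missingPairs G e u u ≡ false
    loopless u = ¬-not λ h → proj₂ (proj₂ (proj₂ (missingPairs-elim h))) refl
    disjoint : ∀ u v → missingPairs G e u v ≡ true → G u v ≡ false
    disjoint u v = proj₁ ∘ missingPairs-elim

  isClique-addMissingPairs : IsClique (addEdges G (missingPairs G e)) e
  isClique-addMissingPairs u v u∈ v∈ u≢v with G u v Bool.≟ true
  ... | yes Guv = addEdges-⊇ G (missingPairs G e) u v Guv
  ... | no ¬Guv = trans (cong (_∨ missingPairs G e u v) (¬-not ¬Guv))
                        (missingPairs-intro (¬-not ¬Guv) u∈ v∈ u≢v)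

module _ (ℓ r : ℕ) (E : EdgeSet n) where

  private
    G = shadow E

  nonEdge-of-nonClique : ∀ {S} → ¬ IsClique G S → E S ≡ false
  nonEdge-of-nonClique ¬cl = ¬-not (¬cl ∘ edge-isClique E)

  saturated⇒CondI : Saturated ℓ r E → CondI r E
  saturated⇒CondI (free , add) S ∣S∣ cl with E S Bool.≟ true
  ... | yes ES = ES
  ... | no ¬ES = contradiction (hasK⇒containsK E bigClique) free
    where
    bigClique : HasK (suc ℓ) G
    bigClique = HasK-mono (shadow-addEdge-⊆ E (λ _ _ → id) cl)
              (containsK⇒hasK (addEdge E S) (add S ∣S∣ (¬-not ¬ES)))

  saturated⇒KrMaximalFree : Saturated ℓ r E → KrMaximalFree r ℓ G
  saturated⇒KrMaximalFree (free , add) = free ∘ hasK⇒containsK E , grow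
    where
    grow : ∀ E′ → NonEdgeSet G E′ → NK r G < NK r (addEdges G E′) → HasK (suc ℓ) (addEdges G E′)
    grow E′ _ more with S , ∣S∣ , cl , ¬cl ← NK-<⇒newClique more =
      HasK-mono (shadow-addEdge-⊆ E (addEdges-⊇ G E′) cl)
        (containsK⇒hasK (addEdge E S) (add S ∣S∣ (nonEdge-of-nonClique ¬cl)))

  CondI∧KrMaximalFree⇒saturated : CondI r E → KrMaximalFree r ℓ G → Saturated ℓ r E
  CondI∧KrMaximalFree⇒saturated condI (free , maximal) = free ∘ containsK⇒hasK E , add
    where
    add : ∀ e → ∣ e ∣ ≡ r → E e ≡ false → ContainsKfam ℓ (addEdge E e)
    add e ∣e∣ Ee = hasK⇒containsK (addEdge E e) (HasK-mono completed⊆shadow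
      (maximal (missingPairs G e) (missingPairs-nonEdgeSet G e (shadow-sym E))
        (newClique⇒NK-< (addEdges-⊇ G _) ∣e∣ (isClique-addMissingPairs G e) ¬cl)))
      where
      ¬cl : ¬ IsClique G e
      ¬cl cl = contradiction (trans (sym (condI e ∣e∣ cl)) Ee) λ ()
      completed⊆shadow : addEdges G (missingPairs G e) ⊆ᴳ shadow (addEdge E e)
      completed⊆shadow = addEdges-⊆ (shadow-mono (addEdge-⊇ E e)) λ u v h →
        let _ , u∈ , v∈ , u≢v = missingPairs-elim G e h
        in shadow-intro (addEdge E e) u≢v (addEdge-new E e , u∈ , v∈)

lemma2p6 : ∀ {n : ℕ} (ℓ r : ℕ) → 3 ≤ r → r ≤ ℓ → (H : RGraph n r) →
    Saturated ℓ r (edge H) ⇔ (CondI r (edge H) × KrMaximalFree r ℓ (shadow (edge H)))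
lemma2p6 ℓ r _ _ H = mk⇔
  (λ sat → saturated⇒CondI ℓ r E sat , saturated⇒KrMaximalFree ℓ r E sat)
  (λ (condI , maximal) → CondI∧KrMaximalFree⇒saturated ℓ r E condI maximal)
  where
  E = edge H
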